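{- Let $G=(V,E)$ be a connected graph, let $(C,+)$ be an Abelian group, let $c\colon V\to C$ be a vertex colouring of $G$ and let $c'$ be the corresponding canonical edge colouring. If an automorphism $\gamma$ of $G$ preserves $c'$ and $c(v)=c(\gamma v)$ for some vertex $v$, then $\gamma$ preserves $c$.
   Context: Graphs are simple and undirected, possibly infinite. The canonical edge colouring of $c$ is $c'(uv)=c(u)+c(v)$ for each edge $uv$. An automorphism $\gamma$ preserves a vertex colouring $c$ if $c(\gamma x)=c(x)$ for all vertices $x$, and preserves an edge colouring $c'$ if $c'(\gamma e)=c'(e)$ for all edges $e$. -}

module Defs where

open import Level using (Level; _⊔_; suc)
open import Data.Product using (_×_; ∃-syntax)
open import Data.List using (List; []; _∷_)
open import Relation.Nullary using (¬_)
open import Relation.Binary.PropositionalEquality using (_≡_)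
open import Function.Bundles using (_⤖_; Bijection)
open import Algebra.Bundles using (AbelianGroup)

record Graph (v e : Level) : Set (suc (v ⊔ e)) where
  field
    V     : Set v
    Adj   : V → V → Set e
    sym   : ∀ {x y} → Adj x y → Adj y x
    irrefl : ∀ {x} → ¬ Adj x x

module _ {v e : Level} (G : Graph v e) where
  open Graph G

  data Walk : V → V → Set (v ⊔ e) where
    here : ∀ {x} → Walk x x
    step : ∀ {x y z} → Adj x y → Walk y z → Walk x z

  Connected : Set (v ⊔ e)
  Connected = ∀ (x y : V) → Walk x y

  record Automorphism : Set (v ⊔ e) where
    field
      bij  : V ⤖ V
    γ : V → V
    γ = Bijection.to bij
    field
      adj-pres : ∀ {x y} → Adj x y → Adj (γ x) (γ y)
      adj-refl : ∀ {x y} → Adj (γ x) (γ y) → Adj x y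

  module _ {c ℓ : Level} (C : AbelianGroup c ℓ) where
    open AbelianGroup C renaming (Carrier to Col)

    canonicalEdge : (V → Col) → (x y : V) → Adj x y → Col
    canonicalEdge col x y _ = col x ∙ col y

    PreservesVertexColouring : Automorphism → (V → Col) → Set (v ⊔ ℓ)
    PreservesVertexColouring a col = ∀ x → col (Automorphism.γ a x) ≈ col x

    PreservesEdgeColouring : Automorphism → (V → Col) → Set (v ⊔ e ⊔ ℓ)
    PreservesEdgeColouring a col =
      ∀ x y (xy : Adj x y) →
        canonicalEdge col (Automorphism.γ a x) (Automorphism.γ a y)
          (Automorphism.adj-pres a xy)
        ≈ canonicalEdge col x y xy

-- If γ fixes the colour of x and xy is an edge, then c(γx) + c(γy) = c(x) + c(y)
-- and cancelling c(γx) = c(x) gives c(γy) = c(y). Connectedness carries this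
-- from the given vertex along a walk to every other vertex.
module Submission where

open import Defs
open import Level using (Level)
open import Data.Product using (∃-syntax; _,_)
open import Algebra.Bundles using (AbelianGroup)
import Algebra.Properties.Group as GroupProperties

module _ {v e : Level} (G : Graph v e) where
  open Graph G

  walk-transport : ∀ {p} (P : V → Set p) →
                   (∀ {x y} → Adj x y → P x → P y) →
                   ∀ {x y} → Walk G x y → P x → P y
  walk-transport P along-edge here        px = px
  walk-transport P along-edge (step xy w) px =
    walk-transport P along-edge w (along-edge xy px)

  module _ {c ℓ : Level} (C : AbelianGroup c ℓ) (col : V → AbelianGroup.Carrier C)
           (a : Automorphism G) (preserves-edges : PreservesEdgeColouring G C a col) where
    open AbelianGroup C
    open GroupProperties group using (∙-cancelˡ)
    open Automorphism a using (γ)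

    Fixed : V → Set ℓ
    Fixed x = col (γ x) ≈ col x

    fixed-adjacent : ∀ {x y} → Adj x y → Fixed x → Fixed y
    fixed-adjacent {x} {y} xy γx≈x = ∙-cancelˡ (col x) (col (γ y)) (col y) (begin
      col x ∙ col (γ y)      ≈⟨ ∙-congʳ γx≈x ⟨
      col (γ x) ∙ col (γ y)  ≈⟨ preserves-edges x y xy ⟩
      col x ∙ col y          ∎)
      where open import Relation.Binary.Reasoning.Setoid setoid

lemma6 : {v e c ℓ : Level} (G : Graph v e) (C : AbelianGroup c ℓ) →
         Connected G →
         (col : Graph.V G → AbelianGroup.Carrier C) →
         (a : Automorphism G) →
         PreservesEdgeColouring G C a col →
         (∃[ x ] AbelianGroup._≈_ C (col x) (col (Automorphism.γ a x))) →
         PreservesVertexColouring G C a col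
lemma6 G C connected col a preserves-edges (x , x≈γx) y =
  walk-transport G (Fixed G C col a preserves-edges)
    (fixed-adjacent G C col a preserves-edges)
    (connected x y) (AbelianGroup.sym C x≈γx)
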